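{- Let $K_{m,n}$ be the complete bipartite graph with edges $e_1,\dots,e_{mn}$ and let $H_1,\dots,H_{mn}$ be graphs, where $H_i$ has $n_i$ vertices. Then $$\chi_{\le 3}(K_{m,n}\diamond(H_1,\dots,H_{mn}))=m+n+\sum_{i=1}^{mn} n_i.$$ In particular, for a graph $H$ with $n_2$ vertices, $\chi_{\le 3}(K_{m,n}\diamond H)=m+n+mn\,n_2$.
   Context: For a simple graph $G$ with edge set $\{e_1,\dots,e_m\}$ and simple graphs $H_1,\dots,H_m$, the generalized edge corona product $G\diamond(H_1,\dots,H_m)$ is the graph obtained by taking one (vertex-disjoint) copy of each of $G,H_1,\dots,H_m$ and joining both end vertices of the $i$-th edge $e_i$ of $G$ to every vertex of $H_i$. When all $H_i$ are copies of one graph $H$, this is written $G\diamond H$. A $k$-distance coloring of a graph is a vertex coloring in which any two distinct vertices at distance at most $k$ receive different colors; $\chi_{\le k}$ denotes the minimum number of colors in a $k$-distance coloring. -}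

module Defs where

open import Data.Nat using (ℕ; zero; suc; _+_; _≤_)
open import Data.Fin using (Fin; zero; suc)
open import Data.Product using (Σ; _×_; _,_; proj₁; proj₂)
open import Data.Sum using (_⊎_; inj₁; inj₂)
open import Data.Unit using (⊤)
open import Relation.Binary.PropositionalEquality using (_≡_; _≢_)
open import Relation.Nullary using (¬_)

record Graph (V : Set) : Set₁ where
  field
    Adj   : V → V → Set
    sym   : ∀ {u v} → Adj u v → Adj v u
    irrefl : ∀ {v} → ¬ Adj v v
open Graph public

data Walk {V : Set} (G : Graph V) : V → V → ℕ → Set where
  nil  : ∀ {u} → Walk G u u zero
  cons : ∀ {u w v l} → Adj G u w → Walk G w v l → Walk G u v (suc l)

DistLe : {V : Set} → Graph V → ℕ → V → V → Set
DistLe G k u v = Σ ℕ λ l → l ≤ k × Walk G u v l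

DistColoring : {V : Set} → Graph V → ℕ → ℕ → Set
DistColoring {V} G k c =
  Σ (V → Fin c) λ f → ∀ u v → u ≢ v → DistLe G k u v → f u ≢ f v

IsDistChromatic : {V : Set} → Graph V → ℕ → ℕ → Set
IsDistChromatic G k c = DistColoring G k c × (∀ c' → DistColoring G k c' → c ≤ c')

data KAdj (m n : ℕ) : Fin m ⊎ Fin n → Fin m ⊎ Fin n → Set where
  lr : ∀ a b → KAdj m n (inj₁ a) (inj₂ b)
  rl : ∀ a b → KAdj m n (inj₂ b) (inj₁ a)

K : (m n : ℕ) → Graph (Fin m ⊎ Fin n)
K m n = record { Adj = KAdj m n ; sym = s ; irrefl = i }
  where
  s : ∀ {u v} → KAdj m n u v → KAdj m n v u
  s (lr a b) = rl a b
  s (rl a b) = lr a b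
  i : ∀ {v} → ¬ KAdj m n v v
  i ()

-- The edges of K_{m,n} are indexed by Fin m × Fin n; edge (a,b) has ends inj₁ a, inj₂ b.
KEnds : (m n : ℕ) → Fin m × Fin n → (Fin m ⊎ Fin n) × (Fin m ⊎ Fin n)
KEnds m n (a , b) = inj₁ a , inj₂ b

-- Generalized edge corona G ◇ (H_e)_{e ∈ E}: G has vertex type V, edges indexed by E
-- with end vertices ends e; H e is a graph on Fin (N e).
CVert : (V E : Set) (N : E → ℕ) → Set
CVert V E N = V ⊎ Σ E (λ e → Fin (N e))

data CAdj {V E : Set} (G : Graph V) (ends : E → V × V) (N : E → ℕ)
          (H : (e : E) → Graph (Fin (N e))) : CVert V E N → CVert V E N → Set where
  gg  : ∀ {u v} → Adj G u v → CAdj G ends N H (inj₁ u) (inj₁ v)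
  hh  : ∀ e {x y} → Adj (H e) x y → CAdj G ends N H (inj₂ (e , x)) (inj₂ (e , y))
  e₁h : ∀ e x → CAdj G ends N H (inj₁ (proj₁ (ends e))) (inj₂ (e , x))
  he₁ : ∀ e x → CAdj G ends N H (inj₂ (e , x)) (inj₁ (proj₁ (ends e)))
  e₂h : ∀ e x → CAdj G ends N H (inj₁ (proj₂ (ends e))) (inj₂ (e , x))
  he₂ : ∀ e x → CAdj G ends N H (inj₂ (e , x)) (inj₁ (proj₂ (ends e)))

-- irreflexivity requires that edge ends are distinct vertices (true for edges of a simple graph)
EdgeCorona : {V E : Set} (G : Graph V) (ends : E → V × V)
             → (∀ e → Adj G (proj₁ (ends e)) (proj₂ (ends e)))
             → (N : E → ℕ) (H : (e : E) → Graph (Fin (N e)))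
             → Graph (CVert V E N)
EdgeCorona {V} {E} G ends isE N H = record { Adj = CAdj G ends N H ; sym = s ; irrefl = i }
  where
  s : ∀ {u v} → CAdj G ends N H u v → CAdj G ends N H v u
  s (gg p) = gg (sym G p)
  s (hh e p) = hh e (sym (H e) p)
  s (e₁h e x) = he₁ e x
  s (he₁ e x) = e₁h e x
  s (e₂h e x) = he₂ e x
  s (he₂ e x) = e₂h e x
  i : ∀ {v} → ¬ CAdj G ends N H v v
  i (gg p) = irrefl G p
  i (hh e p) = irrefl (H e) p

KIsEdge : (m n : ℕ) → ∀ e → Adj (K m n) (proj₁ (KEnds m n e)) (proj₂ (KEnds m n e))
KIsEdge m n (a , b) = lr a b

KCorona : (m n : ℕ) (N : Fin m × Fin n → ℕ) (H : (e : Fin m × Fin n) → Graph (Fin (N e)))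
          → Graph (CVert (Fin m ⊎ Fin n) (Fin m × Fin n) N)
KCorona m n N H = EdgeCorona (K m n) (KEnds m n) (KIsEdge m n) N H

sumFin : (k : ℕ) → (Fin k → ℕ) → ℕ
sumFin zero f = 0
sumFin (suc k) f = f zero + sumFin k (λ i → f (suc i))

module Submission where

-- χ_{≤3}(K_{m,n} ◇ (H_e)) equals the number of vertices of the corona.
--
-- The argument has two independent parts.
--   * A general fact about distance colorings: if every two vertices of a
--     graph are at distance at most k (its diameter is at most k) and its
--     vertex type is in bijection with Fin c, then χ_{≤k} = c.  Indeed the
--     bijection itself is a k-distance coloring with c colors, and a
--     k-distance coloring must give all vertices distinct colors, hence
--     restricts to an injection Fin c → Fin c'.
--   * The corona K_{m,n} ◇ (H_e) with m, n ≥ 1 has diameter at most 3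
--     (explicit walks through the bipartite core), and its vertex type
--     (Fin m ⊎ Fin n) ⊎ Σ_{(a,b)} Fin (N (a,b)) is in bijection with
--     Fin (m + n + Σ_a Σ_b N (a,b)) (counting disjoint unions of Fin's).

open import Defs
open import Data.Nat using (ℕ; zero; suc; _+_; _*_; _≤_; z≤n; s≤s)
open import Data.Nat.Properties using (*-assoc; ≤-refl)
open import Data.Fin using (Fin; _≟_)
open import Data.Fin.Properties using (+↔⊎; injective⇒≤)
open import Data.Product using (Σ; _×_; _,_)
open import Data.Product.Algebra using (Σ-assoc-alt)
open import Data.Product.Function.Dependent.Propositional using (Σ-↔)
open import Data.Sum using (_⊎_; inj₁; inj₂)
open import Data.Sum.Function.Propositional using (_⊎-↔_)
open import Function.Bundles using (Inverse; _↔_; mk↔ₛ′)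
open import Function.Properties.Inverse using (↔-refl; ↔-sym; ↔-trans)
open import Relation.Binary.PropositionalEquality
  using (_≡_; _≢_; refl; cong; subst; module ≡-Reasoning)
  renaming (sym to ≡-sym)
open import Relation.Nullary using (yes; no)
open import Data.Empty using (⊥-elim)

open Inverse using (to; from; strictlyInverseˡ; strictlyInverseʳ)

Diameter≤ : {V : Set} → Graph V → ℕ → Set
Diameter≤ {V} G k = ∀ (u v : V) → DistLe G k u v

walk⇒DistLe : {V : Set} {G : Graph V} {k l : ℕ} {u v : V}
            → l ≤ k → Walk G u v l → DistLe G k u v
walk⇒DistLe {l = l} l≤k w = l , l≤k , w

numbering-coloring : {V : Set} (G : Graph V) (k : ℕ) {c : ℕ}
                   → V ↔ Fin c → DistColoring G k c
numbering-coloring G k V↔c = to V↔c , separates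
  where
  separates : ∀ u v → u ≢ v → DistLe G k u v → to V↔c u ≢ to V↔c v
  separates u v u≢v _ same = u≢v (begin
    u                      ≡⟨ ≡-sym (strictlyInverseʳ V↔c u) ⟩
    from V↔c (to V↔c u)    ≡⟨ cong (from V↔c) same ⟩
    from V↔c (to V↔c v)    ≡⟨ strictlyInverseʳ V↔c v ⟩
    v                      ∎)
    where open ≡-Reasoning

diameter⇒colors≥ : {V : Set} (G : Graph V) (k : ℕ) {c : ℕ}
                 → Diameter≤ G k → V ↔ Fin c
                 → ∀ c' → DistColoring G k c' → c ≤ c'
diameter⇒colors≥ G k close V↔c c' (f , proper) = injective⇒≤ injective
  where
  injective : ∀ {i j} → f (from V↔c i) ≡ f (from V↔c j) → i ≡ j
  injective {i} {j} same with i ≟ j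
  ... | yes i≡j = i≡j
  ... | no  i≢j = ⊥-elim (proper (from V↔c i) (from V↔c j) distinct (close _ _) same)
    where
    distinct : from V↔c i ≢ from V↔c j
    distinct eq = i≢j (begin
      i                      ≡⟨ ≡-sym (strictlyInverseˡ V↔c i) ⟩
      to V↔c (from V↔c i)    ≡⟨ cong (to V↔c) eq ⟩
      to V↔c (from V↔c j)    ≡⟨ strictlyInverseˡ V↔c j ⟩
      j                      ∎)
      where open ≡-Reasoning

diameter⇒χ≡order : {V : Set} (G : Graph V) (k : ℕ) {c : ℕ}
                 → Diameter≤ G k → V ↔ Fin c → IsDistChromatic G k c
diameter⇒χ≡order G k close V↔c =
  numbering-coloring G k V↔c , diameter⇒colors≥ G k close V↔c

Σ-Fin-suc : ∀ k (B : Fin (suc k) → Set)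
          → Σ (Fin (suc k)) B ↔ (B Fin.zero ⊎ Σ (Fin k) (λ i → B (Fin.suc i)))
Σ-Fin-suc k B = mk↔ₛ′ split unsplit split∘unsplit unsplit∘split
  where
  split : Σ (Fin (suc k)) B → B Fin.zero ⊎ Σ (Fin k) (λ i → B (Fin.suc i))
  split (Fin.zero  , x) = inj₁ x
  split (Fin.suc i , x) = inj₂ (i , x)
  unsplit : B Fin.zero ⊎ Σ (Fin k) (λ i → B (Fin.suc i)) → Σ (Fin (suc k)) B
  unsplit (inj₁ x)       = Fin.zero , x
  unsplit (inj₂ (i , x)) = Fin.suc i , x
  split∘unsplit : ∀ y → split (unsplit y) ≡ y
  split∘unsplit (inj₁ x)       = refl
  split∘unsplit (inj₂ (i , x)) = refl
  unsplit∘split : ∀ x → unsplit (split x) ≡ x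
  unsplit∘split (Fin.zero  , x) = refl
  unsplit∘split (Fin.suc i , x) = refl

Σ-Fin↔sumFin : ∀ k (f : Fin k → ℕ) → Σ (Fin k) (λ i → Fin (f i)) ↔ Fin (sumFin k f)
Σ-Fin↔sumFin zero    f = mk↔ₛ′ (λ { (() , _) }) (λ ()) (λ ()) (λ { (() , _) })
Σ-Fin↔sumFin (suc k) f =
  ↔-trans (Σ-Fin-suc k (λ i → Fin (f i)))
    (↔-trans (↔-refl ⊎-↔ Σ-Fin↔sumFin k (λ i → f (Fin.suc i))) (↔-sym +↔⊎))

corona-order : ∀ m n (N : Fin m × Fin n → ℕ)
             → CVert (Fin m ⊎ Fin n) (Fin m × Fin n) N
               ↔ Fin (m + n + sumFin m (λ a → sumFin n (λ b → N (a , b))))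
corona-order m n N = ↔-trans (↔-sym +↔⊎ ⊎-↔ attached) (↔-sym +↔⊎)
  where
  attached : Σ (Fin m × Fin n) (λ e → Fin (N e))
             ↔ Fin (sumFin m (λ a → sumFin n (λ b → N (a , b))))
  attached =
    ↔-trans Σ-assoc-alt
      (↔-trans (Σ-↔ ↔-refl (λ {a} → Σ-Fin↔sumFin n (λ b → N (a , b))))
        (Σ-Fin↔sumFin m (λ a → sumFin n (λ b → N (a , b)))))

-- With a fixed left vertex a₀ and right vertex b₀ (so m, n ≥ 1), any two vertices
-- of K_{m,n} ◇ (H_e) are joined by a walk of length ≤ 3: two core vertices on the
-- same side meet through a₀ or b₀, and a vertex of H_(a,b) reaches the core
-- through a or b.
corona-diameter≤3 : ∀ m n (a₀ : Fin m) (b₀ : Fin n) (N : Fin m × Fin n → ℕ)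
                    (H : (e : Fin m × Fin n) → Graph (Fin (N e)))
                  → Diameter≤ (KCorona m n N H) 3
corona-diameter≤3 m n a₀ b₀ N H = close
  where
  G : Graph (CVert (Fin m ⊎ Fin n) (Fin m × Fin n) N)
  G = KCorona m n N H

  step : ∀ {u v} → Adj G u v → DistLe G 3 u v
  step p = walk⇒DistLe (s≤s z≤n) (cons p nil)

  path2 : ∀ {u w v} → Adj G u w → Adj G w v → DistLe G 3 u v
  path2 p q = walk⇒DistLe (s≤s (s≤s z≤n)) (cons p (cons q nil))

  path3 : ∀ {u w w' v} → Adj G u w → Adj G w w' → Adj G w' v → DistLe G 3 u v
  path3 p q r = walk⇒DistLe ≤-refl (cons p (cons q (cons r nil)))

  close : Diameter≤ G 3
  close (inj₁ (inj₁ a)) (inj₁ (inj₁ a'))        = path2 (gg (lr a b₀)) (gg (rl a' b₀))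
  close (inj₁ (inj₁ a)) (inj₁ (inj₂ b))         = step (gg (lr a b))
  close (inj₁ (inj₁ a)) (inj₂ ((a' , b') , y))  = path2 (gg (lr a b')) (e₂h (a' , b') y)
  close (inj₁ (inj₂ b)) (inj₁ (inj₁ a))         = step (gg (rl a b))
  close (inj₁ (inj₂ b)) (inj₁ (inj₂ b'))        = path2 (gg (rl a₀ b)) (gg (lr a₀ b'))
  close (inj₁ (inj₂ b)) (inj₂ ((a' , b') , y))  = path2 (gg (rl a' b)) (e₁h (a' , b') y)
  close (inj₂ ((a , b) , x)) (inj₁ (inj₁ a'))   = path2 (he₂ (a , b) x) (gg (rl a' b))
  close (inj₂ ((a , b) , x)) (inj₁ (inj₂ b'))   = path2 (he₁ (a , b) x) (gg (lr a b'))
  close (inj₂ ((a , b) , x)) (inj₂ ((a' , b') , y)) =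
    path3 (he₁ (a , b) x) (gg (lr a b')) (e₂h (a' , b') y)

sumFin-const : ∀ k c → sumFin k (λ _ → c) ≡ k * c
sumFin-const zero    c = refl
sumFin-const (suc k) c = cong (c +_) (sumFin-const k c)

edge-sum-const : ∀ m n n₂ → sumFin m (λ _ → sumFin n (λ _ → n₂)) ≡ m * n * n₂
edge-sum-const m n n₂ = begin
  sumFin m (λ _ → sumFin n (λ _ → n₂))  ≡⟨ cong (λ s → sumFin m (λ _ → s)) (sumFin-const n n₂) ⟩
  sumFin m (λ _ → n * n₂)               ≡⟨ sumFin-const m (n * n₂) ⟩
  m * (n * n₂)                          ≡⟨ ≡-sym (*-assoc m n n₂) ⟩
  m * n * n₂                            ∎
  where open ≡-Reasoning

first : ∀ {m} → 1 ≤ m → Fin m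
first (s≤s _) = Fin.zero

mainTheorem10 : ((m n : ℕ) → 1 ≤ m → 1 ≤ n
    → (N : Fin m × Fin n → ℕ) (H : (e : Fin m × Fin n) → Graph (Fin (N e)))
    → IsDistChromatic (KCorona m n N H) 3
    (m + n + sumFin m (λ a → sumFin n (λ b → N (a , b)))))
    × ((m n n₂ : ℕ) → 1 ≤ m → 1 ≤ n → (H : Graph (Fin n₂))
    → IsDistChromatic (KCorona m n (λ _ → n₂) (λ _ → H)) 3 (m + n + m * n * n₂))
mainTheorem10 = general , uniform
  where
  general : (m n : ℕ) → 1 ≤ m → 1 ≤ n
          → (N : Fin m × Fin n → ℕ) (H : (e : Fin m × Fin n) → Graph (Fin (N e)))
          → IsDistChromatic (KCorona m n N H) 3
              (m + n + sumFin m (λ a → sumFin n (λ b → N (a , b))))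
  general m n 1≤m 1≤n N H =
    diameter⇒χ≡order (KCorona m n N H) 3
      (corona-diameter≤3 m n (first 1≤m) (first 1≤n) N H) (corona-order m n N)

  uniform : (m n n₂ : ℕ) → 1 ≤ m → 1 ≤ n → (H : Graph (Fin n₂))
          → IsDistChromatic (KCorona m n (λ _ → n₂) (λ _ → H)) 3 (m + n + m * n * n₂)
  uniform m n n₂ 1≤m 1≤n H =
    subst (IsDistChromatic (KCorona m n (λ _ → n₂) (λ _ → H)) 3)
      (cong (m + n +_) (edge-sum-const m n n₂))
      (general m n 1≤m 1≤n (λ _ → n₂) (λ _ → H))
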